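{- Let $k\in\mathbb{Z}$ and let $n,m\in\mathbb{N}$ with $m$ odd. Then $$E_{n-1}^{(k)}(x)=\sum_{l=0}^{n-1}\binom{n-1}{l}m^{l}\sum_{j=1}^{n-l}\sum_{s=0}^{m-1}(-1)^sE_{l}\Big(\frac{s+x}{m}\Big)\frac{1}{j^{k-1}}\frac{S_{1}(n-l,j)}{n-l}.$$
   Context: The Euler polynomials $E_n(x)$ are defined by $\frac{2}{e^t+1}e^{xt}=\sum_{n=0}^\infty E_n(x)\frac{t^n}{n!}$. For $k\in\mathbb{Z}$, $\mathrm{Ei}_k(x)=\sum_{n=1}^{\infty}\frac{x^n}{n^k (n-1)!}$; the poly-Genocchi polynomials $G_n^{(k)}(x)$ are defined by $\frac{2\,\mathrm{Ei}_k(\log(1+t))}{e^t+1}e^{xt}=\sum_{n=0}^{\infty}G_n^{(k)}(x)\frac{t^n}{n!}$, and the poly-Euler polynomials are $E_n^{(k)}(x)=\frac{G_{n+1}^{(k)}(x)}{n+1}$ ($n\ge0$). $S_1(n,m)$ are the signed Stirling numbers of the first kind: $\frac{(\log(1+t))^m}{m!}=\sum_{n\ge m}S_1(n,m)\frac{t^n}{n!}$. -}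

module Defs where

open import Data.Nat as ℕ using (ℕ; zero; suc; _∸_; _≤ᵇ_; _!)
open import Data.Nat.Properties using (m^n≢0)
open import Data.Nat.Combinatorics using (_C_)
open import Data.Integer as ℤ using (ℤ; +_; -[1+_])
open import Data.Rational using (ℚ; _/_; _+_; _*_; _-_; -_; 0ℚ; 1ℚ; ½)
open import Data.Bool using (if_then_else_)

ℕ→ℚ : ℕ → ℚ
ℕ→ℚ n = + n / 1

ℤ→ℚ : ℤ → ℚ
ℤ→ℚ z = z / 1

_^q_ : ℚ → ℕ → ℚ
x ^q zero = 1ℚ
x ^q suc n = x * (x ^q n)

Σ< : ℕ → (ℕ → ℚ) → ℚ
Σ< zero f = 0ℚ
Σ< (suc n) f = Σ< n f + f n

-- division of a rational by a natural number (only used with d ≥ 1;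
-- the value at d = 0 is an irrelevant junk value 0)
_÷ℕ_ : ℚ → ℕ → ℚ
x ÷ℕ zero = 0ℚ
x ÷ℕ suc d = x * (+ 1 / suc d)

sgn : ℕ → ℚ
sgn zero = 1ℚ
sgn (suc n) = - sgn n

-- Exponential generating functions are represented by their coefficient
-- sequences: f ↔ Σ f(n) t^n/n!.  Product of EGFs (binomial convolution):
egfMul : (ℕ → ℚ) → (ℕ → ℚ) → (ℕ → ℚ)
egfMul f g n = Σ< (suc n) (λ i → ℕ→ℚ (n C i) * (f i * g (n ∸ i)))

-- log(1+t) = Σ_{n≥1} (-1)^{n-1} (n-1)! t^n/n!
logCoeff : ℕ → ℚ
logCoeff zero = 0ℚ
logCoeff (suc n) = sgn n * ℕ→ℚ (n !)

-- (log(1+t))^m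
logPow : ℕ → (ℕ → ℚ)
logPow zero zero = 1ℚ
logPow zero (suc n) = 0ℚ
logPow (suc m) = egfMul logCoeff (logPow m)

-- signed Stirling numbers of the first kind:
-- (log(1+t))^m / m! = Σ_n S₁(n,m) t^n/n!
S₁ : ℕ → ℕ → ℚ
S₁ n m = logPow m n ÷ℕ (m !)

-- Euler polynomials: comparing coefficients of t^n/n! in
-- (e^t + 1) Σ E_n(x) t^n/n! = 2 e^{xt}  gives
-- E_n(x) + Σ_{i=0}^{n} C(n,i) E_i(x) = 2 x^n, i.e.
-- E_n(x) = ½ (2 x^n - Σ_{i<n} C(n,i) E_i(x)).
-- EulerTab x n i = E_i(x) for all i ≤ n.
EulerTab : ℚ → ℕ → ℕ → ℚ
EulerTab x zero i = 1ℚ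
EulerTab x (suc n) i =
  if i ≤ᵇ n then EulerTab x n i
  else ½ * (ℕ→ℚ 2 * (x ^q suc n)
            - Σ< (suc n) (λ j → ℕ→ℚ (suc n C j) * EulerTab x n j))

EulerPoly : ℕ → ℚ → ℚ
EulerPoly n x = EulerTab x n n

-- j^{1-k} = 1 / j^{k-1}, for j ≥ 1 and k ∈ ℤ (value at j = 0 is junk 0)
invPowZ : ℕ → ℤ → ℚ
invPowZ zero k = 0ℚ
invPowZ (suc j) k with k ℤ.- ℤ.+ 1
... | + p = + 1 / (suc j ℕ.^ p)
  where instance _ = m^n≢0 (suc j) p
... | -[1+ p ] = ℕ→ℚ (suc j ℕ.^ suc p)

-- Ei_k(u) = Σ_{m≥1} u^m/(m^k (m-1)!) = Σ_{m≥1} m^{1-k} u^m/m!, so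
-- Ei_k(log(1+t)) = Σ_{m≥1} m^{1-k} (log(1+t))^m/m!
--               = Σ_n (Σ_{m=1}^{n} m^{1-k} S₁(n,m)) t^n/n!
EiLogCoeff : ℤ → ℕ → ℚ
EiLogCoeff k n = Σ< n (λ i → invPowZ (suc i) k * S₁ n (suc i))

-- 2/(e^t+1) e^{xt} = Σ E_n(x) t^n/n!, hence
-- 2 Ei_k(log(1+t))/(e^t+1) e^{xt} = (Ei_k(log(1+t))) · (Σ E_n(x) t^n/n!)
polyGenocchi : ℤ → ℕ → ℚ → ℚ
polyGenocchi k n x = egfMul (EiLogCoeff k) (λ i → EulerPoly i x) n

-- poly-Euler polynomials E_n^{(k)}(x) = G_{n+1}^{(k)}(x)/(n+1)
polyEuler : ℤ → ℕ → ℚ → ℚ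
polyEuler k n x = polyGenocchi k (suc n) x ÷ℕ suc n

-- E^{(k)}_{n-1}(x) = G^{(k)}_n(x)/n, and G^{(k)}_n(x) is the binomial convolution of the Euler
-- polynomials Eₗ(x) with the coefficients of Ei_k(log(1+t)).  Each Eₗ(x) is replaced by the
-- multiplication formula Eₗ(x) = mˡ Σ_{s<m} (-1)ˢ Eₗ((s+x)/m), valid for odd m, and
-- C(n,l)/n = C(n-1,l)/(n-l).  The multiplication formula holds because both sides satisfy
-- E_N(x) + Σ_{i≤N} C(N,i) E_i(x) = 2xᴺ, the coefficientwise form of (eᵗ+1)E(t) = 2e^{xt},
-- which determines the sequence.  For the right-hand side, multiplying by eᵗ translates each
-- argument (s+x)/m by 1/m (translation formula E_N(y+h) = Σ C(N,i) E_i(y) h^{N-i}), so the two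
-- terms of the recurrence form an alternating sum which, m being odd, telescopes to
-- E_N(x/m) + E_N(x/m + 1).

module Submission where

open import Defs
open import Data.Bool using (false)
open import Data.Bool.Properties using (T-≡; if-cong)
open import Data.Integer as ℤ using (ℤ)
import Data.Integer.Properties as ℤP
open import Data.Nat as ℕ using (ℕ; zero; suc; _∸_; _%_; _≤_; _<_; _≤ᵇ_; z≤n; s≤s)
import Data.Nat.Properties as ℕP
open import Data.Nat.Combinatorics using (_C_; nCk+nC[k+1]≡[n+1]C[k+1]; k>n⇒nCk≡0; nCn≡1; nC1≡n)
open import Data.Nat.DivMod using (m≡m%n+[m/n]*n)
open import Data.Nat.Induction using (<-rec)
open import Data.Nat.Tactic.RingSolver using (solve-∀)
open import Data.Sum using (inj₁; inj₂)
open import Data.Rational using (ℚ; _/_; _+_; _*_; _-_; -_; 0ℚ; 1ℚ; ½; toℚᵘ)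
import Data.Rational.Properties as ℚP
import Data.Rational.Unnormalised as ℚᵘ
import Data.Rational.Unnormalised.Properties as ℚᵘP
open import Data.Rational.Solver using (module +-*-Solver)
open +-*-Solver
open import Function.Bundles using (Equivalence)
open import Relation.Binary.PropositionalEquality

-- x ÷ℕ suc d unfolds to x * 1/[1+ d ].
1/[1+_] : ℕ → ℚ
1/[1+ d ] = ℤ.+ 1 / suc d

toℚᵘ-ℕ→ℚ : ∀ n → toℚᵘ (ℕ→ℚ n) ℚᵘ.≃ ℚᵘ.mkℚᵘ (ℤ.+ n) 0
toℚᵘ-ℕ→ℚ n = ℚP.toℚᵘ-fromℚᵘ (ℚᵘ.mkℚᵘ (ℤ.+ n) 0)

ℕ→ℚ-+ : ∀ a b → ℕ→ℚ (a ℕ.+ b) ≡ ℕ→ℚ a + ℕ→ℚ b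
ℕ→ℚ-+ a b = ℚP.toℚᵘ-injective (begin
  toℚᵘ (ℕ→ℚ (a ℕ.+ b))                     ≈⟨ toℚᵘ-ℕ→ℚ (a ℕ.+ b) ⟩
  ℚᵘ.mkℚᵘ (ℤ.+ (a ℕ.+ b)) 0                 ≈⟨ ℚᵘ.*≡* cross ⟩
  ℚᵘ.mkℚᵘ (ℤ.+ a) 0 ℚᵘ.+ ℚᵘ.mkℚᵘ (ℤ.+ b) 0 ≈⟨ ℚᵘP.+-cong (toℚᵘ-ℕ→ℚ a) (toℚᵘ-ℕ→ℚ b) ⟨
  toℚᵘ (ℕ→ℚ a) ℚᵘ.+ toℚᵘ (ℕ→ℚ b)           ≈⟨ ℚP.toℚᵘ-homo-+ (ℕ→ℚ a) (ℕ→ℚ b) ⟨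
  toℚᵘ (ℕ→ℚ a + ℕ→ℚ b)                      ∎)
  where
  open ℚᵘP.≃-Reasoning
  cross : ℤ.+ (a ℕ.+ b) ℤ.* ℤ.+ 1 ≡ (ℤ.+ a ℤ.* ℤ.+ 1 ℤ.+ ℤ.+ b ℤ.* ℤ.+ 1) ℤ.* ℤ.+ 1
  cross = cong (ℤ._* ℤ.+ 1) (trans (ℤP.pos-+ a b)
    (sym (cong₂ ℤ._+_ (ℤP.*-identityʳ (ℤ.+ a)) (ℤP.*-identityʳ (ℤ.+ b)))))

ℕ→ℚ-* : ∀ a b → ℕ→ℚ (a ℕ.* b) ≡ ℕ→ℚ a * ℕ→ℚ b
ℕ→ℚ-* a b = ℚP.toℚᵘ-injective (begin
  toℚᵘ (ℕ→ℚ (a ℕ.* b))                     ≈⟨ toℚᵘ-ℕ→ℚ (a ℕ.* b) ⟩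
  ℚᵘ.mkℚᵘ (ℤ.+ (a ℕ.* b)) 0                 ≈⟨ ℚᵘ.*≡* (cong (ℤ._* ℤ.+ 1) (ℤP.pos-* a b)) ⟩
  ℚᵘ.mkℚᵘ (ℤ.+ a) 0 ℚᵘ.* ℚᵘ.mkℚᵘ (ℤ.+ b) 0 ≈⟨ ℚᵘP.*-cong (toℚᵘ-ℕ→ℚ a) (toℚᵘ-ℕ→ℚ b) ⟨
  toℚᵘ (ℕ→ℚ a) ℚᵘ.* toℚᵘ (ℕ→ℚ b)           ≈⟨ ℚP.toℚᵘ-homo-* (ℕ→ℚ a) (ℕ→ℚ b) ⟨
  toℚᵘ (ℕ→ℚ a * ℕ→ℚ b)                      ∎)
  where open ℚᵘP.≃-Reasoning

1/[1+]-inverseʳ : ∀ d → ℕ→ℚ (suc d) * 1/[1+ d ] ≡ 1ℚ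
1/[1+]-inverseʳ d = ℚP.toℚᵘ-injective (begin
  toℚᵘ (ℕ→ℚ (suc d) * 1/[1+ d ])               ≈⟨ ℚP.toℚᵘ-homo-* (ℕ→ℚ (suc d)) 1/[1+ d ] ⟩
  toℚᵘ (ℕ→ℚ (suc d)) ℚᵘ.* toℚᵘ 1/[1+ d ]      ≈⟨ ℚᵘP.*-cong (toℚᵘ-ℕ→ℚ (suc d)) (ℚP.toℚᵘ-fromℚᵘ (ℚᵘ.mkℚᵘ (ℤ.+ 1) d)) ⟩
  ℚᵘ.mkℚᵘ (ℤ.+ suc d) 0 ℚᵘ.* ℚᵘ.mkℚᵘ (ℤ.+ 1) d ≈⟨ ℚᵘ.*≡* cross ⟩
  toℚᵘ 1ℚ                                       ∎)
  where
  open ℚᵘP.≃-Reasoning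
  cross : ℤ.+ suc d ℤ.* ℤ.+ 1 ℤ.* ℤ.+ 1 ≡ ℤ.+ 1 ℤ.* ℤ.+ (1 ℕ.* suc d)
  cross = trans (trans (ℤP.*-identityʳ _) (ℤP.*-identityʳ _))
                (sym (trans (ℤP.*-identityˡ _) (cong ℤ.+_ (ℕP.*-identityˡ (suc d)))))

open ≡-Reasoning

ℕ→ℚ-C-suc : ∀ n k → ℕ→ℚ (suc n C suc k) ≡ ℕ→ℚ (n C k) + ℕ→ℚ (n C suc k)
ℕ→ℚ-C-suc n k = trans (cong ℕ→ℚ (sym (nCk+nC[k+1]≡[n+1]C[k+1] n k))) (ℕ→ℚ-+ (n C k) (n C suc k))

ℕ→ℚ-cross-multiplication : ∀ a b c d → suc d ℕ.* a ≡ suc c ℕ.* b →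
                           ℕ→ℚ a * 1/[1+ c ] ≡ ℕ→ℚ b * 1/[1+ d ]
ℕ→ℚ-cross-multiplication a b c d eq = begin
  ℕ→ℚ a * 1/[1+ c ]                                         ≡⟨ ℚP.*-identityʳ _ ⟨
  ℕ→ℚ a * 1/[1+ c ] * 1ℚ                                    ≡⟨ cong (ℕ→ℚ a * 1/[1+ c ] *_) (1/[1+]-inverseʳ d) ⟨
  ℕ→ℚ a * 1/[1+ c ] * (ℕ→ℚ (suc d) * 1/[1+ d ])             ≡⟨ swap (ℕ→ℚ a) 1/[1+ c ] (ℕ→ℚ (suc d)) 1/[1+ d ] ⟩
  ℕ→ℚ (suc d) * ℕ→ℚ a * (1/[1+ d ] * 1/[1+ c ])             ≡⟨ cong (_* (1/[1+ d ] * 1/[1+ c ])) (ℕ→ℚ-* (suc d) a) ⟨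
  ℕ→ℚ (suc d ℕ.* a) * (1/[1+ d ] * 1/[1+ c ])               ≡⟨ cong (λ n → ℕ→ℚ n * (1/[1+ d ] * 1/[1+ c ])) eq ⟩
  ℕ→ℚ (suc c ℕ.* b) * (1/[1+ d ] * 1/[1+ c ])               ≡⟨ cong (_* (1/[1+ d ] * 1/[1+ c ])) (ℕ→ℚ-* (suc c) b) ⟩
  ℕ→ℚ (suc c) * ℕ→ℚ b * (1/[1+ d ] * 1/[1+ c ])             ≡⟨ swap′ (ℕ→ℚ (suc c)) (ℕ→ℚ b) 1/[1+ d ] 1/[1+ c ] ⟩
  ℕ→ℚ (suc c) * 1/[1+ c ] * (ℕ→ℚ b * 1/[1+ d ])             ≡⟨ cong (_* (ℕ→ℚ b * 1/[1+ d ])) (1/[1+]-inverseʳ c) ⟩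
  1ℚ * (ℕ→ℚ b * 1/[1+ d ])                                  ≡⟨ ℚP.*-identityˡ _ ⟩
  ℕ→ℚ b * 1/[1+ d ]                                         ∎
  where
  swap : ∀ p q r s → p * q * (r * s) ≡ r * p * (s * q)
  swap = solve 4 (λ p q r s → p :* q :* (r :* s) := r :* p :* (s :* q)) refl
  swap′ : ∀ p q r s → p * q * (r * s) ≡ p * s * (q * r)
  swap′ = solve 4 (λ p q r s → p :* q :* (r :* s) := p :* s :* (q :* r)) refl

Σ<-cong< : ∀ n {f g : ℕ → ℚ} → (∀ i → i < n → f i ≡ g i) → Σ< n f ≡ Σ< n g
Σ<-cong< zero    f≗g = refl
Σ<-cong< (suc n) f≗g = cong₂ _+_ (Σ<-cong< n (λ i i<n → f≗g i (ℕP.m<n⇒m<1+n i<n))) (f≗g n ℕP.≤-refl)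

Σ<-cong : ∀ n {f g : ℕ → ℚ} → (∀ i → f i ≡ g i) → Σ< n f ≡ Σ< n g
Σ<-cong n f≗g = Σ<-cong< n (λ i _ → f≗g i)

Σ<-zero : ∀ n → Σ< n (λ _ → 0ℚ) ≡ 0ℚ
Σ<-zero zero    = refl
Σ<-zero (suc n) = trans (ℚP.+-identityʳ _) (Σ<-zero n)

Σ<-+ : ∀ n (f g : ℕ → ℚ) → Σ< n (λ i → f i + g i) ≡ Σ< n f + Σ< n g
Σ<-+ zero    f g = refl
Σ<-+ (suc n) f g = trans (cong (_+ (f n + g n)) (Σ<-+ n f g)) (interchange (Σ< n f) (Σ< n g) (f n) (g n))
  where
  interchange : ∀ a b c d → (a + b) + (c + d) ≡ (a + c) + (b + d)
  interchange = solve 4 (λ a b c d → (a :+ b) :+ (c :+ d) := (a :+ c) :+ (b :+ d)) refl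

*-distribˡ-Σ< : ∀ n c (f : ℕ → ℚ) → c * Σ< n f ≡ Σ< n (λ i → c * f i)
*-distribˡ-Σ< zero    c f = ℚP.*-zeroʳ c
*-distribˡ-Σ< (suc n) c f = trans (ℚP.*-distribˡ-+ c (Σ< n f) (f n)) (cong (_+ c * f n) (*-distribˡ-Σ< n c f))

*-distribʳ-Σ< : ∀ n c (f : ℕ → ℚ) → Σ< n f * c ≡ Σ< n (λ i → f i * c)
*-distribʳ-Σ< zero    c f = ℚP.*-zeroˡ c
*-distribʳ-Σ< (suc n) c f = trans (ℚP.*-distribʳ-+ c (Σ< n f) (f n)) (cong (_+ f n * c) (*-distribʳ-Σ< n c f))

Σ<-suc : ∀ n (f : ℕ → ℚ) → Σ< (suc n) f ≡ f 0 + Σ< n (λ i → f (suc i))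
Σ<-suc zero    f = ℚP.+-comm 0ℚ (f 0)
Σ<-suc (suc n) f = trans (cong (_+ f (suc n)) (Σ<-suc n f)) (ℚP.+-assoc (f 0) _ _)

Σ<-comm : ∀ n m (f : ℕ → ℕ → ℚ) → Σ< n (λ i → Σ< m (f i)) ≡ Σ< m (λ j → Σ< n (λ i → f i j))
Σ<-comm zero    m f = sym (Σ<-zero m)
Σ<-comm (suc n) m f = trans (cong (_+ Σ< m (f n)) (Σ<-comm n m f)) (sym (Σ<-+ m _ (f n)))

Σ<-*-Σ< : ∀ m n (a b : ℕ → ℚ) → Σ< m a * Σ< n b ≡ Σ< n (λ j → Σ< m (λ s → a s * b j))
Σ<-*-Σ< m n a b = trans (*-distribˡ-Σ< n (Σ< m a) b) (Σ<-cong n (λ j → *-distribʳ-Σ< m (b j) a))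

Σ<-alternating-telescope : ∀ n (g : ℕ → ℚ) →
  Σ< n (λ s → sgn s * g s) + Σ< n (λ s → sgn s * g (suc s)) ≡ g 0 - sgn n * g n
Σ<-alternating-telescope zero    g = solve 1 (λ a → con 0ℚ :+ con 0ℚ := a :- con 1ℚ :* a) refl (g 0)
Σ<-alternating-telescope (suc n) g = begin
  (A + σ * g n) + (B + σ * g (suc n)) ≡⟨ regroup A B (g n) (g (suc n)) σ ⟩
  (A + B) + σ * g n + σ * g (suc n)   ≡⟨ cong (λ t → t + σ * g n + σ * g (suc n)) (Σ<-alternating-telescope n g) ⟩
  (g 0 - σ * g n) + σ * g n + σ * g (suc n) ≡⟨ cancel (g 0) (g n) (g (suc n)) σ ⟩
  g 0 - (- σ) * g (suc n)             ∎
  where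
  A = Σ< n (λ s → sgn s * g s)
  B = Σ< n (λ s → sgn s * g (suc s))
  σ = sgn n
  regroup : ∀ A B a b σ → (A + σ * a) + (B + σ * b) ≡ (A + B) + σ * a + σ * b
  regroup = solve 5 (λ A B a b σ → (A :+ σ :* a) :+ (B :+ σ :* b) := (A :+ B) :+ σ :* a :+ σ :* b) refl
  cancel : ∀ g₀ a b σ → (g₀ - σ * a) + σ * a + σ * b ≡ g₀ - (- σ) * b
  cancel = solve 4 (λ g₀ a b σ → (g₀ :- σ :* a) :+ σ :* a :+ σ :* b := g₀ :- (:- σ) :* b) refl

÷ℕ-distrib-Σ< : ∀ n d (f : ℕ → ℚ) → Σ< n f ÷ℕ d ≡ Σ< n (λ i → f i ÷ℕ d)
÷ℕ-distrib-Σ< n zero    f = sym (Σ<-zero n)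
÷ℕ-distrib-Σ< n (suc d) f = *-distribʳ-Σ< n 1/[1+ d ] f

*-÷ℕ-assoc : ∀ p q d → (p * q) ÷ℕ d ≡ p * (q ÷ℕ d)
*-÷ℕ-assoc p q zero    = sym (ℚP.*-zeroʳ p)
*-÷ℕ-assoc p q (suc d) = ℚP.*-assoc p q 1/[1+ d ]

egfMul-cong : ∀ {f f′ g g′ : ℕ → ℚ} → (∀ i → f i ≡ f′ i) → (∀ i → g i ≡ g′ i) →
              ∀ n → egfMul f g n ≡ egfMul f′ g′ n
egfMul-cong f≗f′ g≗g′ n =
  Σ<-cong (suc n) (λ i → cong₂ (λ u v → ℕ→ℚ (n C i) * (u * v)) (f≗f′ i) (g≗g′ (n ∸ i)))

egfMul-zero : ∀ (f g : ℕ → ℚ) → egfMul f g 0 ≡ f 0 * g 0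
egfMul-zero f g = solve 1 (λ a → con 0ℚ :+ con 1ℚ :* a := a) refl (f 0 * g 0)

-- Leibniz rule: shifting coefficients is differentiation of the EGF.
egfMul-suc : ∀ (f g : ℕ → ℚ) n →
  egfMul f g (suc n) ≡ egfMul (λ i → f (suc i)) g n + egfMul f (λ i → g (suc i)) n
egfMul-suc f g n = begin
  egfMul f g (suc n)
    ≡⟨ Σ<-suc (suc n) _ ⟩
  a₀ + Σ< (suc n) (λ i → ℕ→ℚ (suc n C suc i) * (f (suc i) * g (n ∸ i)))
    ≡⟨ cong (a₀ +_) (trans (Σ<-cong (suc n) (λ i → pascal i)) (Σ<-+ (suc n) _ b)) ⟩
  a₀ + (egfMul f′ g n + (Σ< n b + b n))
    ≡⟨ cong (λ t → a₀ + (egfMul f′ g n + (Σ< n b + t))) bₙ≡0 ⟩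
  a₀ + (egfMul f′ g n + (Σ< n b + 0ℚ))
    ≡⟨ regroup a₀ (egfMul f′ g n) (Σ< n b) ⟩
  egfMul f′ g n + (a₀ + Σ< n b)
    ≡⟨ cong (λ t → egfMul f′ g n + (a₀ + t)) (Σ<-cong< n b≡c∘suc) ⟩
  egfMul f′ g n + (a₀ + Σ< n (λ i → c (suc i)))
    ≡⟨ cong (egfMul f′ g n +_) (Σ<-suc n c) ⟨
  egfMul f′ g n + egfMul f (λ i → g (suc i)) n ∎
  where
  f′ : ℕ → ℚ
  f′ i = f (suc i)
  a₀ = ℕ→ℚ (suc n C 0) * (f 0 * g (suc n))
  b c : ℕ → ℚ
  b i = ℕ→ℚ (n C suc i) * (f (suc i) * g (n ∸ i))
  c i = ℕ→ℚ (n C i) * (f i * g (suc (n ∸ i)))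
  pascal : ∀ i → ℕ→ℚ (suc n C suc i) * (f (suc i) * g (n ∸ i)) ≡ ℕ→ℚ (n C i) * (f (suc i) * g (n ∸ i)) + b i
  pascal i = trans (cong (_* (f (suc i) * g (n ∸ i))) (ℕ→ℚ-C-suc n i))
                     (ℚP.*-distribʳ-+ (f (suc i) * g (n ∸ i)) (ℕ→ℚ (n C i)) (ℕ→ℚ (n C suc i)))
  bₙ≡0 : b n ≡ 0ℚ
  bₙ≡0 = trans (cong (λ k → ℕ→ℚ k * (f (suc n) * g (n ∸ n))) (k>n⇒nCk≡0 (ℕP.n<1+n n)))
               (ℚP.*-zeroˡ (f (suc n) * g (n ∸ n)))
  b≡c∘suc : ∀ i → i < n → b i ≡ c (suc i)
  b≡c∘suc i i<n = cong (λ k → ℕ→ℚ (n C suc i) * (f (suc i) * g k)) (ℕP.+-∸-assoc 1 i<n)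
  regroup : ∀ a A B → a + (A + (B + 0ℚ)) ≡ A + (a + B)
  regroup = solve 3 (λ a A B → a :+ (A :+ (B :+ con 0ℚ)) := A :+ (a :+ B)) refl

egfMul-distribʳ : ∀ (f g h : ℕ → ℚ) n → egfMul (λ i → f i + g i) h n ≡ egfMul f h n + egfMul g h n
egfMul-distribʳ f g h n = trans
  (Σ<-cong (suc n) (λ i → distrib (ℕ→ℚ (n C i)) (f i) (g i) (h (n ∸ i))))
  (Σ<-+ (suc n) (λ i → ℕ→ℚ (n C i) * (f i * h (n ∸ i))) (λ i → ℕ→ℚ (n C i) * (g i * h (n ∸ i))))
  where
  distrib : ∀ c a b d → c * ((a + b) * d) ≡ c * (a * d) + c * (b * d)
  distrib = solve 4 (λ c a b d → c :* ((a :+ b) :* d) := c :* (a :* d) :+ c :* (b :* d)) refl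

egfMul-distribˡ : ∀ (f g h : ℕ → ℚ) n → egfMul f (λ i → g i + h i) n ≡ egfMul f g n + egfMul f h n
egfMul-distribˡ f g h n = trans
  (Σ<-cong (suc n) (λ i → distrib (ℕ→ℚ (n C i)) (f i) (g (n ∸ i)) (h (n ∸ i))))
  (Σ<-+ (suc n) (λ i → ℕ→ℚ (n C i) * (f i * g (n ∸ i))) (λ i → ℕ→ℚ (n C i) * (f i * h (n ∸ i))))
  where
  distrib : ∀ c d a b → c * (d * (a + b)) ≡ c * (d * a) + c * (d * b)
  distrib = solve 4 (λ c d a b → c :* (d :* (a :+ b)) := c :* (d :* a) :+ c :* (d :* b)) refl

egfMul-*ˡ : ∀ p (f g : ℕ → ℚ) n → egfMul (λ i → p * f i) g n ≡ p * egfMul f g n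
egfMul-*ˡ p f g n = trans
  (Σ<-cong (suc n) (λ i → pull (ℕ→ℚ (n C i)) (f i) (g (n ∸ i)) p))
  (sym (*-distribˡ-Σ< (suc n) p (λ i → ℕ→ℚ (n C i) * (f i * g (n ∸ i)))))
  where
  pull : ∀ c a b p → c * ((p * a) * b) ≡ p * (c * (a * b))
  pull = solve 4 (λ c a b p → c :* ((p :* a) :* b) := p :* (c :* (a :* b))) refl

egfMul-*ʳ : ∀ p (f g : ℕ → ℚ) n → egfMul f (λ i → p * g i) n ≡ p * egfMul f g n
egfMul-*ʳ p f g n = trans
  (Σ<-cong (suc n) (λ i → pull (ℕ→ℚ (n C i)) (f i) (g (n ∸ i)) p))
  (sym (*-distribˡ-Σ< (suc n) p (λ i → ℕ→ℚ (n C i) * (f i * g (n ∸ i)))))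
  where
  pull : ∀ c a b p → c * (a * (p * b)) ≡ p * (c * (a * b))
  pull = solve 4 (λ c a b p → c :* (a :* (p :* b)) := p :* (c :* (a :* b))) refl

egfMul-Σ<ˡ : ∀ m (f : ℕ → ℕ → ℚ) (g : ℕ → ℚ) n →
  egfMul (λ i → Σ< m (λ s → f s i)) g n ≡ Σ< m (λ s → egfMul (f s) g n)
egfMul-Σ<ˡ m f g n = begin
  Σ< (suc n) (λ i → ℕ→ℚ (n C i) * (Σ< m (λ s → f s i) * g (n ∸ i)))
    ≡⟨ Σ<-cong (suc n) (λ i → trans (cong (ℕ→ℚ (n C i) *_) (*-distribʳ-Σ< m (g (n ∸ i)) (λ s → f s i)))
                                    (*-distribˡ-Σ< m (ℕ→ℚ (n C i)) (λ s → f s i * g (n ∸ i)))) ⟩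
  Σ< (suc n) (λ i → Σ< m (λ s → ℕ→ℚ (n C i) * (f s i * g (n ∸ i))))
    ≡⟨ Σ<-comm (suc n) m _ ⟩
  Σ< m (λ s → egfMul (f s) g n) ∎

egfMul-comm : ∀ n (f g : ℕ → ℚ) → egfMul f g n ≡ egfMul g f n
egfMul-comm zero f g = trans (egfMul-zero f g) (trans (ℚP.*-comm (f 0) (g 0)) (sym (egfMul-zero g f)))
egfMul-comm (suc n) f g = begin
  egfMul f g (suc n)                      ≡⟨ egfMul-suc f g n ⟩
  egfMul f′ g n + egfMul f g′ n           ≡⟨ cong₂ _+_ (egfMul-comm n f′ g) (egfMul-comm n f g′) ⟩
  egfMul g f′ n + egfMul g′ f n           ≡⟨ ℚP.+-comm (egfMul g f′ n) (egfMul g′ f n) ⟩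
  egfMul g′ f n + egfMul g f′ n           ≡⟨ egfMul-suc g f n ⟨
  egfMul g f (suc n)                      ∎
  where
  f′ g′ : ℕ → ℚ
  f′ i = f (suc i)
  g′ i = g (suc i)

egfMul-assoc : ∀ n (f g h : ℕ → ℚ) → egfMul (egfMul f g) h n ≡ egfMul f (egfMul g h) n
egfMul-assoc zero f g h = begin
  egfMul (egfMul f g) h 0   ≡⟨ egfMul-zero (egfMul f g) h ⟩
  egfMul f g 0 * h 0        ≡⟨ cong (_* h 0) (egfMul-zero f g) ⟩
  f 0 * g 0 * h 0           ≡⟨ ℚP.*-assoc (f 0) (g 0) (h 0) ⟩
  f 0 * (g 0 * h 0)         ≡⟨ cong (f 0 *_) (egfMul-zero g h) ⟨
  f 0 * egfMul g h 0        ≡⟨ egfMul-zero f (egfMul g h) ⟨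
  egfMul f (egfMul g h) 0   ∎
egfMul-assoc (suc n) f g h = begin
  egfMul (egfMul f g) h (suc n)
    ≡⟨ egfMul-suc (egfMul f g) h n ⟩
  egfMul (λ i → egfMul f g (suc i)) h n + egfMul (egfMul f g) h′ n
    ≡⟨ cong (_+ egfMul (egfMul f g) h′ n)
            (trans (egfMul-cong {f = λ i → egfMul f g (suc i)} {g = h} (λ i → egfMul-suc f g i) (λ _ → refl) n)
                   (egfMul-distribʳ (egfMul f′ g) (egfMul f g′) h n)) ⟩
  (egfMul (egfMul f′ g) h n + egfMul (egfMul f g′) h n) + egfMul (egfMul f g) h′ n
    ≡⟨ cong₂ _+_ (cong₂ _+_ (egfMul-assoc n f′ g h) (egfMul-assoc n f g′ h)) (egfMul-assoc n f g h′) ⟩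
  (egfMul f′ (egfMul g h) n + egfMul f (egfMul g′ h) n) + egfMul f (egfMul g h′) n
    ≡⟨ ℚP.+-assoc (egfMul f′ (egfMul g h) n) _ _ ⟩
  egfMul f′ (egfMul g h) n + (egfMul f (egfMul g′ h) n + egfMul f (egfMul g h′) n)
    ≡⟨ cong (egfMul f′ (egfMul g h) n +_)
            (trans (egfMul-cong {f = f} {g = λ i → egfMul g h (suc i)} (λ _ → refl) (λ i → egfMul-suc g h i) n)
                   (egfMul-distribˡ f (egfMul g′ h) (egfMul g h′) n)) ⟨
  egfMul f′ (egfMul g h) n + egfMul f (λ i → egfMul g h (suc i)) n
    ≡⟨ egfMul-suc f (egfMul g h) n ⟨
  egfMul f (egfMul g h) (suc n) ∎
  where
  f′ g′ h′ : ℕ → ℚ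
  f′ i = f (suc i)
  g′ i = g (suc i)
  h′ i = h (suc i)

^q-distribˡ-+-* : ∀ p a b → p ^q (a ℕ.+ b) ≡ p ^q a * p ^q b
^q-distribˡ-+-* p zero    b = sym (ℚP.*-identityˡ (p ^q b))
^q-distribˡ-+-* p (suc a) b = trans (cong (p *_) (^q-distribˡ-+-* p a b)) (sym (ℚP.*-assoc p (p ^q a) (p ^q b)))

^q-distribʳ-* : ∀ p q n → (p * q) ^q n ≡ p ^q n * q ^q n
^q-distribʳ-* p q zero    = refl
^q-distribʳ-* p q (suc n) = trans (cong ((p * q) *_) (^q-distribʳ-* p q n)) (interchange p q (p ^q n) (q ^q n))
  where
  interchange : ∀ a b c d → (a * b) * (c * d) ≡ (a * c) * (b * d)
  interchange = solve 4 (λ a b c d → (a :* b) :* (c :* d) := (a :* c) :* (b :* d)) refl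

1^q≡1 : ∀ n → 1ℚ ^q n ≡ 1ℚ
1^q≡1 zero    = refl
1^q≡1 (suc n) = trans (ℚP.*-identityˡ _) (1^q≡1 n)

^q-complement : ∀ p {i n} → i ≤ n → p ^q i * p ^q (n ∸ i) ≡ p ^q n
^q-complement p {i} {n} i≤n = trans (sym (^q-distribˡ-+-* p i (n ∸ i))) (cong (p ^q_) (ℕP.m+[n∸m]≡n i≤n))

binomial-theorem : ∀ p q n → egfMul (p ^q_) (q ^q_) n ≡ (p + q) ^q n
binomial-theorem p q zero    = refl
binomial-theorem p q (suc n) = begin
  egfMul (p ^q_) (q ^q_) (suc n)                                           ≡⟨ egfMul-suc (p ^q_) (q ^q_) n ⟩
  egfMul (λ i → p * p ^q i) (q ^q_) n + egfMul (p ^q_) (λ i → q * q ^q i) n ≡⟨ cong₂ _+_ (egfMul-*ˡ p (p ^q_) (q ^q_) n) (egfMul-*ʳ q (p ^q_) (q ^q_) n) ⟩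
  p * egfMul (p ^q_) (q ^q_) n + q * egfMul (p ^q_) (q ^q_) n              ≡⟨ ℚP.*-distribʳ-+ (egfMul (p ^q_) (q ^q_) n) p q ⟨
  (p + q) * egfMul (p ^q_) (q ^q_) n                                       ≡⟨ cong ((p + q) *_) (binomial-theorem p q n) ⟩
  (p + q) ^q suc n                                                          ∎

egfMul-^q-scale : ∀ c (f g : ℕ → ℚ) n →
  egfMul (λ i → c ^q i * f i) (λ i → c ^q i * g i) n ≡ c ^q n * egfMul f g n
egfMul-^q-scale c f g n = trans
  (Σ<-cong< (suc n) (λ i i≤n → trans (pull (ℕ→ℚ (n C i)) (c ^q i) (c ^q (n ∸ i)) (f i) (g (n ∸ i)))
                                      (cong (λ t → t * (ℕ→ℚ (n C i) * (f i * g (n ∸ i)))) (^q-complement c (ℕP.≤-pred i≤n)))))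
  (sym (*-distribˡ-Σ< (suc n) (c ^q n) (λ i → ℕ→ℚ (n C i) * (f i * g (n ∸ i)))))
  where
  pull : ∀ b u v a e → b * ((u * a) * (v * e)) ≡ (u * v) * (b * (a * e))
  pull = solve 5 (λ b u v a e → b :* ((u :* a) :* (v :* e)) := (u :* v) :* (b :* (a :* e))) refl

-- (eᵗ + 1) G(t) = 2 e^{xt}, compared coefficientwise.
EulerRecurrence : ℚ → (ℕ → ℚ) → Set
EulerRecurrence x G = ∀ N → G N + egfMul (1ℚ ^q_) G N ≡ ℕ→ℚ 2 * x ^q N

egfMul-1^q : ∀ (G : ℕ → ℚ) N → egfMul (1ℚ ^q_) G N ≡ Σ< N (λ i → ℕ→ℚ (N C i) * G i) + G N
egfMul-1^q G N = trans (egfMul-comm N (1ℚ ^q_) G) (cong₂ _+_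
  (Σ<-cong N (λ i → cong (ℕ→ℚ (N C i) *_) (drop1 (G i) (N ∸ i))))
  (trans (cong (λ k → ℕ→ℚ k * (G N * 1ℚ ^q (N ∸ N))) (nCn≡1 N)) (trans (ℚP.*-identityˡ _) (drop1 (G N) (N ∸ N)))))
  where
  drop1 : ∀ a k → a * 1ℚ ^q k ≡ a
  drop1 a k = trans (cong (a *_) (1^q≡1 k)) (ℚP.*-identityʳ a)

a+[s+a]≡b+[s+b]⇒a≡b : ∀ a b s → a + (s + a) ≡ b + (s + b) → a ≡ b
a+[s+a]≡b+[s+b]⇒a≡b a b s eq = begin
  a                       ≡⟨ solve 2 (λ a s → a := con ½ :* ((a :+ (s :+ a)) :- s)) refl a s ⟩
  ½ * ((a + (s + a)) - s) ≡⟨ cong (λ t → ½ * (t - s)) eq ⟩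
  ½ * ((b + (s + b)) - s) ≡⟨ solve 2 (λ b s → con ½ :* ((b :+ (s :+ b)) :- s) := b) refl b s ⟩
  b                       ∎

EulerRecurrence-unique : ∀ {x G H} → EulerRecurrence x G → EulerRecurrence x H → ∀ N → G N ≡ H N
EulerRecurrence-unique {x} {G} {H} recG recH = <-rec (λ N → G N ≡ H N) step
  where
  step : ∀ N → (∀ {i} → i < N → G i ≡ H i) → G N ≡ H N
  step N G≡H-below = a+[s+a]≡b+[s+b]⇒a≡b (G N) (H N) (S H) (begin
    G N + (S H + G N)          ≡⟨ cong (λ t → G N + (t + G N)) SG≡SH ⟨
    G N + (S G + G N)          ≡⟨ cong (G N +_) (egfMul-1^q G N) ⟨
    G N + egfMul (1ℚ ^q_) G N  ≡⟨ trans (recG N) (sym (recH N)) ⟩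
    H N + egfMul (1ℚ ^q_) H N  ≡⟨ cong (H N +_) (egfMul-1^q H N) ⟩
    H N + (S H + H N)          ∎)
    where
    S : (ℕ → ℚ) → ℚ
    S F = Σ< N (λ i → ℕ→ℚ (N C i) * F i)
    SG≡SH : S G ≡ S H
    SG≡SH = Σ<-cong< N (λ i i<N → cong (ℕ→ℚ (N C i) *_) (G≡H-below i<N))

1+n≤ᵇn≡false : ∀ n → (suc n ≤ᵇ n) ≡ false
1+n≤ᵇn≡false zero    = refl
1+n≤ᵇn≡false (suc n) = 1+n≤ᵇn≡false n

EulerTab-suc-≤ : ∀ x {n i} → i ≤ n → EulerTab x (suc n) i ≡ EulerTab x n i
EulerTab-suc-≤ x {n} {i} i≤n = if-cong {x = EulerTab x n i} (Equivalence.to T-≡ (ℕP.≤⇒≤ᵇ i≤n))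

EulerTab-suc-top : ∀ x n → EulerTab x (suc n) (suc n) ≡
  ½ * (ℕ→ℚ 2 * x ^q suc n - Σ< (suc n) (λ j → ℕ→ℚ (suc n C j) * EulerTab x n j))
EulerTab-suc-top x n = if-cong {x = EulerTab x n (suc n)} (1+n≤ᵇn≡false n)

EulerTab≡EulerPoly : ∀ x {n i} → i ≤ n → EulerTab x n i ≡ EulerPoly i x
EulerTab≡EulerPoly x {zero}  z≤n = refl
EulerTab≡EulerPoly x {suc n} i≤1+n with ℕP.m≤n⇒m<n∨m≡n i≤1+n
... | inj₁ (s≤s i≤n) = trans (EulerTab-suc-≤ x i≤n) (EulerTab≡EulerPoly x i≤n)
... | inj₂ refl      = refl

EulerPoly-recurrence : ∀ x → EulerRecurrence x (λ i → EulerPoly i x)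
EulerPoly-recurrence x zero    = refl
EulerPoly-recurrence x (suc n) = begin
  E (suc n) + egfMul (1ℚ ^q_) E (suc n)   ≡⟨ cong (E (suc n) +_) (egfMul-1^q E (suc n)) ⟩
  E (suc n) + (S + E (suc n))             ≡⟨ cong (λ e → e + (S + e)) E[1+n]≡ ⟩
  ½ * (2xⁿ⁺¹ - S) + (S + ½ * (2xⁿ⁺¹ - S)) ≡⟨ solve 2 (λ p S → con ½ :* (p :- S) :+ (S :+ con ½ :* (p :- S)) := p) refl 2xⁿ⁺¹ S ⟩
  2xⁿ⁺¹                                   ∎
  where
  E : ℕ → ℚ
  E i = EulerPoly i x
  2xⁿ⁺¹ = ℕ→ℚ 2 * x ^q suc n
  S = Σ< (suc n) (λ i → ℕ→ℚ (suc n C i) * E i)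
  E[1+n]≡ : E (suc n) ≡ ½ * (2xⁿ⁺¹ - S)
  E[1+n]≡ = trans (EulerTab-suc-top x n) (cong (λ t → ½ * (2xⁿ⁺¹ - t))
    (Σ<-cong< (suc n) (λ j j<1+n → cong (ℕ→ℚ (suc n C j) *_) (EulerTab≡EulerPoly x (ℕP.≤-pred j<1+n)))))

EulerPoly-+ : ∀ x h N → EulerPoly N (x + h) ≡ egfMul (λ i → EulerPoly i x) (h ^q_) N
EulerPoly-+ x h = EulerRecurrence-unique (EulerPoly-recurrence (x + h)) recT
  where
  E T : ℕ → ℚ
  E i = EulerPoly i x
  T = egfMul E (h ^q_)
  recT : EulerRecurrence (x + h) T
  recT N = begin
    T N + egfMul (1ℚ ^q_) T N                               ≡⟨ cong (T N +_) (egfMul-assoc N (1ℚ ^q_) E (h ^q_)) ⟨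
    T N + egfMul (egfMul (1ℚ ^q_) E) (h ^q_) N              ≡⟨ egfMul-distribʳ E (egfMul (1ℚ ^q_) E) (h ^q_) N ⟨
    egfMul (λ i → E i + egfMul (1ℚ ^q_) E i) (h ^q_) N      ≡⟨ egfMul-cong {g = h ^q_} (EulerPoly-recurrence x) (λ _ → refl) N ⟩
    egfMul (λ i → ℕ→ℚ 2 * x ^q i) (h ^q_) N                 ≡⟨ egfMul-*ˡ (ℕ→ℚ 2) (x ^q_) (h ^q_) N ⟩
    ℕ→ℚ 2 * egfMul (x ^q_) (h ^q_) N                        ≡⟨ cong (ℕ→ℚ 2 *_) (binomial-theorem x h N) ⟩
    ℕ→ℚ 2 * (x + h) ^q N                                    ∎

EulerPoly-+1 : ∀ x N → EulerPoly N x + EulerPoly N (x + 1ℚ) ≡ ℕ→ℚ 2 * x ^q N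
EulerPoly-+1 x N = begin
  EulerPoly N x + EulerPoly N (x + 1ℚ)                         ≡⟨ cong (EulerPoly N x +_) (EulerPoly-+ x 1ℚ N) ⟩
  EulerPoly N x + egfMul (λ i → EulerPoly i x) (1ℚ ^q_) N     ≡⟨ cong (EulerPoly N x +_) (egfMul-comm N (λ i → EulerPoly i x) (1ℚ ^q_)) ⟩
  EulerPoly N x + egfMul (1ℚ ^q_) (λ i → EulerPoly i x) N     ≡⟨ EulerPoly-recurrence x N ⟩
  ℕ→ℚ 2 * x ^q N                                               ∎

sgn-even : ∀ q → sgn (q ℕ.* 2) ≡ 1ℚ
sgn-even zero    = refl
sgn-even (suc q) = trans (solve 1 (λ a → :- (:- a) := a) refl (sgn (q ℕ.* 2))) (sgn-even q)

sgn-odd : ∀ m → m % 2 ≡ 1 → sgn m ≡ - 1ℚ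
sgn-odd m m%2≡1 = begin
  sgn m                         ≡⟨ cong sgn (m≡m%n+[m/n]*n m 2) ⟩
  sgn (m % 2 ℕ.+ m ℕ./ 2 ℕ.* 2) ≡⟨ cong (λ r → sgn (r ℕ.+ m ℕ./ 2 ℕ.* 2)) m%2≡1 ⟩
  - sgn (m ℕ./ 2 ℕ.* 2)         ≡⟨ cong -_ (sgn-even (m ℕ./ 2)) ⟩
  - 1ℚ                          ∎

multiplicationSum : ℕ → ℚ → ℕ → ℚ
multiplicationSum m x N = ℕ→ℚ m ^q N * Σ< m (λ s → sgn s * EulerPoly N ((ℕ→ℚ s + x) ÷ℕ m))

module _ (m′ : ℕ) where
  private
    m = suc m′
    M = ℕ→ℚ m
    r = 1/[1+ m′ ]

    y : ℚ → ℕ → ℚ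
    y x s = (ℕ→ℚ s + x) ÷ℕ m

    A : ℚ → ℕ → ℚ
    A x N = Σ< m (λ s → sgn s * EulerPoly N (y x s))

    Mⁱrⁱ≡1 : ∀ i → M ^q i * r ^q i ≡ 1ℚ
    Mⁱrⁱ≡1 i = trans (sym (^q-distribʳ-* M r i)) (trans (cong (_^q i) (1/[1+]-inverseʳ m′)) (1^q≡1 i))

  multiplicationSum-shift : ∀ x N → egfMul (1ℚ ^q_) (multiplicationSum m x) N ≡ multiplicationSum m (x + 1ℚ) N
  multiplicationSum-shift x N = begin
    egfMul (1ℚ ^q_) (λ i → M ^q i * A x i) N
      ≡⟨ egfMul-cong {g = λ i → M ^q i * A x i} (λ i → trans (1^q≡1 i) (sym (Mⁱrⁱ≡1 i))) (λ _ → refl) N ⟩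
    egfMul (λ i → M ^q i * r ^q i) (λ i → M ^q i * A x i) N
      ≡⟨ egfMul-^q-scale M (r ^q_) (A x) N ⟩
    M ^q N * egfMul (r ^q_) (A x) N
      ≡⟨ cong (M ^q N *_) (trans (egfMul-comm N (r ^q_) (A x))
                                 (egfMul-Σ<ˡ m (λ s i → sgn s * EulerPoly i (y x s)) (r ^q_) N)) ⟩
    M ^q N * Σ< m (λ s → egfMul (λ i → sgn s * EulerPoly i (y x s)) (r ^q_) N)
      ≡⟨ cong (M ^q N *_) (Σ<-cong m translate) ⟩
    multiplicationSum m (x + 1ℚ) N ∎
    where
    translate : ∀ s → egfMul (λ i → sgn s * EulerPoly i (y x s)) (r ^q_) N ≡ sgn s * EulerPoly N (y (x + 1ℚ) s)
    translate s = begin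
      egfMul (λ i → sgn s * EulerPoly i (y x s)) (r ^q_) N  ≡⟨ egfMul-*ˡ (sgn s) (λ i → EulerPoly i (y x s)) (r ^q_) N ⟩
      sgn s * egfMul (λ i → EulerPoly i (y x s)) (r ^q_) N  ≡⟨ cong (sgn s *_) (EulerPoly-+ (y x s) r N) ⟨
      sgn s * EulerPoly N (y x s + r)                        ≡⟨ cong (λ z → sgn s * EulerPoly N z) y[x+1]≡y+r ⟨
      sgn s * EulerPoly N (y (x + 1ℚ) s)                     ∎
      where
      y[x+1]≡y+r : y (x + 1ℚ) s ≡ y x s + r
      y[x+1]≡y+r = solve 3 (λ a x r → (a :+ (x :+ con 1ℚ)) :* r := (a :+ x) :* r :+ r) refl (ℕ→ℚ s) x r

  multiplicationSum-+1 : sgn m ≡ - 1ℚ → ∀ x N →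
    multiplicationSum m x N + multiplicationSum m (x + 1ℚ) N ≡ ℕ→ℚ 2 * x ^q N
  multiplicationSum-+1 m-odd x N = begin
    M ^q N * Σ< m (λ s → sgn s * g s) + M ^q N * A (x + 1ℚ) N
      ≡⟨ cong (λ t → M ^q N * Σ< m (λ s → sgn s * g s) + M ^q N * t)
              (Σ<-cong m (λ s → cong (λ z → sgn s * EulerPoly N z) (y[x+1]≡y∘suc s))) ⟩
    M ^q N * Σ< m (λ s → sgn s * g s) + M ^q N * Σ< m (λ s → sgn s * g (suc s))
      ≡⟨ ℚP.*-distribˡ-+ (M ^q N) _ _ ⟨
    M ^q N * (Σ< m (λ s → sgn s * g s) + Σ< m (λ s → sgn s * g (suc s)))
      ≡⟨ cong (M ^q N *_) (Σ<-alternating-telescope m g) ⟩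
    M ^q N * (g 0 - sgn m * g m)
      ≡⟨ cong (λ σ → M ^q N * (g 0 - σ * g m)) m-odd ⟩
    M ^q N * (g 0 - (- 1ℚ) * g m)
      ≡⟨ cong (M ^q N *_) (trans (solve 2 (λ a b → a :- (:- con 1ℚ) :* b := a :+ b) refl (g 0) (g m))
                                 (cong₂ (λ u v → EulerPoly N u + EulerPoly N v) y₀≡x/m yₘ≡x/m+1)) ⟩
    M ^q N * (EulerPoly N (x * r) + EulerPoly N (x * r + 1ℚ))
      ≡⟨ cong (M ^q N *_) (trans (EulerPoly-+1 (x * r) N) (cong (ℕ→ℚ 2 *_) (^q-distribʳ-* x r N))) ⟩
    M ^q N * (ℕ→ℚ 2 * (x ^q N * r ^q N))
      ≡⟨ solve 4 (λ a t b c → a :* (t :* (b :* c)) := t :* b :* (a :* c)) refl (M ^q N) (ℕ→ℚ 2) (x ^q N) (r ^q N) ⟩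
    ℕ→ℚ 2 * x ^q N * (M ^q N * r ^q N)
      ≡⟨ trans (cong (ℕ→ℚ 2 * x ^q N *_) (Mⁱrⁱ≡1 N)) (ℚP.*-identityʳ _) ⟩
    ℕ→ℚ 2 * x ^q N ∎
    where
    g : ℕ → ℚ
    g s = EulerPoly N (y x s)
    y[x+1]≡y∘suc : ∀ s → y (x + 1ℚ) s ≡ y x (suc s)
    y[x+1]≡y∘suc s = trans (solve 3 (λ a x r → (a :+ (x :+ con 1ℚ)) :* r := (con 1ℚ :+ a :+ x) :* r)
                                    refl (ℕ→ℚ s) x r)
                           (cong (λ w → (w + x) * r) (sym (ℕ→ℚ-+ 1 s)))
    y₀≡x/m : y x 0 ≡ x * r
    y₀≡x/m = solve 2 (λ x r → (con 0ℚ :+ x) :* r := x :* r) refl x r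
    yₘ≡x/m+1 : y x m ≡ x * r + 1ℚ
    yₘ≡x/m+1 = trans (solve 3 (λ M x r → (M :+ x) :* r := x :* r :+ M :* r) refl M x r)
                     (cong (x * r +_) (1/[1+]-inverseʳ m′))

  multiplicationSum-recurrence : sgn m ≡ - 1ℚ → ∀ x → EulerRecurrence x (multiplicationSum m x)
  multiplicationSum-recurrence m-odd x N =
    trans (cong (multiplicationSum m x N +_) (multiplicationSum-shift x N)) (multiplicationSum-+1 m-odd x N)

EulerPoly-multiplication : ∀ m → m % 2 ≡ 1 → ∀ x N → multiplicationSum m x N ≡ EulerPoly N x
EulerPoly-multiplication zero     ()
EulerPoly-multiplication (suc m′) m-odd x =
  EulerRecurrence-unique (multiplicationSum-recurrence m′ (sgn-odd (suc m′) m-odd) x) (EulerPoly-recurrence x)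

C-absorption : ∀ n k → suc k ℕ.* (suc n C suc k) ≡ suc n ℕ.* (n C k)
C-absorption zero    zero    = refl
C-absorption zero    (suc k) = begin
  suc (suc k) ℕ.* (1 C suc (suc k)) ≡⟨ cong (suc (suc k) ℕ.*_) (k>n⇒nCk≡0 {1} {suc (suc k)} (s≤s (s≤s z≤n))) ⟩
  suc (suc k) ℕ.* 0                 ≡⟨ ℕP.*-zeroʳ (suc (suc k)) ⟩
  0                                 ≡⟨ cong (1 ℕ.*_) (k>n⇒nCk≡0 {0} {suc k} (s≤s z≤n)) ⟨
  1 ℕ.* (0 C suc k)                 ∎
C-absorption (suc n) zero    =
  trans (ℕP.*-identityˡ _) (trans (nC1≡n (suc (suc n))) (sym (ℕP.*-identityʳ (suc (suc n)))))
C-absorption (suc n) (suc k) = begin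
  (2 ℕ.+ k) ℕ.* (suc (suc n) C suc (suc k))
    ≡⟨ cong ((2 ℕ.+ k) ℕ.*_) (nCk+nC[k+1]≡[n+1]C[k+1] (suc n) (suc k)) ⟨
  (2 ℕ.+ k) ℕ.* (a ℕ.+ b)
    ≡⟨ split k a b ⟩
  a ℕ.+ ((1 ℕ.+ k) ℕ.* a ℕ.+ (2 ℕ.+ k) ℕ.* b)
    ≡⟨ cong₂ (λ u v → a ℕ.+ (u ℕ.+ v)) (C-absorption n k) (C-absorption n (suc k)) ⟩
  a ℕ.+ ((1 ℕ.+ n) ℕ.* (n C k) ℕ.+ (1 ℕ.+ n) ℕ.* (n C suc k))
    ≡⟨ cong (a ℕ.+_) (ℕP.*-distribˡ-+ (1 ℕ.+ n) (n C k) (n C suc k)) ⟨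
  a ℕ.+ (1 ℕ.+ n) ℕ.* (n C k ℕ.+ n C suc k)
    ≡⟨ cong (λ t → a ℕ.+ (1 ℕ.+ n) ℕ.* t) (nCk+nC[k+1]≡[n+1]C[k+1] n k) ⟩
  (2 ℕ.+ n) ℕ.* a ∎
  where
  a = suc n C suc k
  b = suc n C suc (suc k)
  split : ∀ k a b → (2 ℕ.+ k) ℕ.* (a ℕ.+ b) ≡ a ℕ.+ ((1 ℕ.+ k) ℕ.* a ℕ.+ (2 ℕ.+ k) ℕ.* b)
  split = solve-∀

-- Adding l·C(n+1,l) = (n+1)·C(n,l-1) to both sides gives (n+1)·C(n+1,l) twice.
C-complement-absorption : ∀ n {l} → l ≤ suc n → suc n ℕ.* (n C l) ≡ (suc n ∸ l) ℕ.* (suc n C l)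
C-complement-absorption n {zero}  _         = refl
C-complement-absorption n {suc j} (s≤s j≤n) = ℕP.+-cancelʳ-≡ (suc j ℕ.* a) _ _ (begin
  suc n ℕ.* (n C suc j) ℕ.+ suc j ℕ.* a        ≡⟨ cong (suc n ℕ.* (n C suc j) ℕ.+_) (C-absorption n j) ⟩
  suc n ℕ.* (n C suc j) ℕ.+ suc n ℕ.* (n C j)  ≡⟨ ℕP.*-distribˡ-+ (suc n) (n C suc j) (n C j) ⟨
  suc n ℕ.* (n C suc j ℕ.+ n C j)              ≡⟨ cong (suc n ℕ.*_) pascal ⟩
  suc n ℕ.* a                                  ≡⟨ cong (ℕ._* a) n∸j+[1+j]≡1+n ⟨
  (n ∸ j ℕ.+ suc j) ℕ.* a                      ≡⟨ ℕP.*-distribʳ-+ a (n ∸ j) (suc j) ⟩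
  (n ∸ j) ℕ.* a ℕ.+ suc j ℕ.* a                ∎)
  where
  a = suc n C suc j
  pascal : n C suc j ℕ.+ n C j ≡ a
  pascal = trans (ℕP.+-comm (n C suc j) (n C j)) (nCk+nC[k+1]≡[n+1]C[k+1] n j)
  n∸j+[1+j]≡1+n : n ∸ j ℕ.+ suc j ≡ suc n
  n∸j+[1+j]≡1+n = trans (ℕP.+-suc (n ∸ j) j) (cong suc (ℕP.m∸n+n≡m j≤n))

ℕ→ℚ-C-suc/[1+n] : ∀ n {l} → l ≤ n → ℕ→ℚ (suc n C l) * 1/[1+ n ] ≡ ℕ→ℚ (n C l) * 1/[1+ n ∸ l ]
ℕ→ℚ-C-suc/[1+n] n {l} l≤n = ℕ→ℚ-cross-multiplication (suc n C l) (n C l) n (n ∸ l)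
  (trans (cong (ℕ._* (suc n C l)) (sym (ℕP.+-∸-assoc 1 l≤n)))
         (sym (C-complement-absorption n (ℕP.m≤n⇒m≤1+n l≤n))))

polyEuler-expansion : ∀ k n x → polyEuler k n x ≡
  Σ< (suc n) (λ l → ℕ→ℚ (n C l) * EulerPoly l x * (EiLogCoeff k (suc n ∸ l) ÷ℕ (suc n ∸ l)))
polyEuler-expansion k n x = begin
  egfMul Ei E (suc n) * 1/[1+ n ]               ≡⟨ cong (_* 1/[1+ n ]) (egfMul-comm (suc n) Ei E) ⟩
  (Σ< (suc n) t + top) * 1/[1+ n ]              ≡⟨ cong (λ z → (Σ< (suc n) t + z) * 1/[1+ n ]) top≡0 ⟩
  (Σ< (suc n) t + 0ℚ) * 1/[1+ n ]               ≡⟨ cong (_* 1/[1+ n ]) (ℚP.+-identityʳ (Σ< (suc n) t)) ⟩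
  Σ< (suc n) t * 1/[1+ n ]                      ≡⟨ *-distribʳ-Σ< (suc n) 1/[1+ n ] t ⟩
  Σ< (suc n) (λ l → t l * 1/[1+ n ])            ≡⟨ Σ<-cong< (suc n) (λ l l<1+n → term l (ℕP.≤-pred l<1+n)) ⟩
  Σ< (suc n) (λ l → ℕ→ℚ (n C l) * E l * (Ei (suc n ∸ l) ÷ℕ (suc n ∸ l))) ∎
  where
  Ei E t : ℕ → ℚ
  Ei = EiLogCoeff k
  E i = EulerPoly i x
  t l = ℕ→ℚ (suc n C l) * (E l * Ei (suc n ∸ l))
  top = ℕ→ℚ (suc n C suc n) * (E (suc n) * Ei (n ∸ n))
  -- Ei 0 = 0: Ei_k(log(1+t)) has no constant term.
  top≡0 : top ≡ 0ℚ
  top≡0 = trans (cong (λ d → ℕ→ℚ (suc n C suc n) * (E (suc n) * Ei d)) (ℕP.n∸n≡0 n))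
                (trans (cong (ℕ→ℚ (suc n C suc n) *_) (ℚP.*-zeroʳ (E (suc n))))
                       (ℚP.*-zeroʳ (ℕ→ℚ (suc n C suc n))))
  term : ∀ l → l ≤ n → t l * 1/[1+ n ] ≡ ℕ→ℚ (n C l) * E l * (Ei (suc n ∸ l) ÷ℕ (suc n ∸ l))
  term l l≤n = begin
    ℕ→ℚ (suc n C l) * (E l * Ei (suc n ∸ l)) * 1/[1+ n ]      ≡⟨ pull-right (ℕ→ℚ (suc n C l)) (E l) (Ei (suc n ∸ l)) 1/[1+ n ] ⟩
    ℕ→ℚ (suc n C l) * 1/[1+ n ] * (E l * Ei (suc n ∸ l))      ≡⟨ cong (_* (E l * Ei (suc n ∸ l))) (ℕ→ℚ-C-suc/[1+n] n l≤n) ⟩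
    ℕ→ℚ (n C l) * 1/[1+ n ∸ l ] * (E l * Ei (suc n ∸ l))      ≡⟨ push-left (ℕ→ℚ (n C l)) 1/[1+ n ∸ l ] (E l) (Ei (suc n ∸ l)) ⟩
    ℕ→ℚ (n C l) * E l * (Ei (suc n ∸ l) ÷ℕ suc (n ∸ l))       ≡⟨ cong (λ d → ℕ→ℚ (n C l) * E l * (Ei (suc n ∸ l) ÷ℕ d)) (ℕP.+-∸-assoc 1 l≤n) ⟨
    ℕ→ℚ (n C l) * E l * (Ei (suc n ∸ l) ÷ℕ (suc n ∸ l))       ∎
    where
    pull-right : ∀ c e i r → c * (e * i) * r ≡ c * r * (e * i)
    pull-right = solve 4 (λ c e i r → c :* (e :* i) :* r := c :* r :* (e :* i)) refl
    push-left : ∀ c r e i → c * r * (e * i) ≡ c * e * (i * r)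
    push-left = solve 4 (λ c r e i → c :* r :* (e :* i) := c :* e :* (i :* r)) refl

Σ<-*-Σ<-÷ℕ : ∀ m n d (a b e : ℕ → ℚ) →
  Σ< m a * (Σ< n (λ j → b j * e j) ÷ℕ d) ≡ Σ< n (λ j → Σ< m (λ s → a s * b j * (e j ÷ℕ d)))
Σ<-*-Σ<-÷ℕ m n d a b e = begin
  Σ< m a * (Σ< n (λ j → b j * e j) ÷ℕ d)
    ≡⟨ cong (Σ< m a *_) (trans (÷ℕ-distrib-Σ< n d _) (Σ<-cong n (λ j → *-÷ℕ-assoc (b j) (e j) d))) ⟩
  Σ< m a * Σ< n (λ j → b j * (e j ÷ℕ d))
    ≡⟨ Σ<-*-Σ< m n a _ ⟩
  Σ< n (λ j → Σ< m (λ s → a s * (b j * (e j ÷ℕ d))))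
    ≡⟨ Σ<-cong n (λ j → Σ<-cong m (λ s → ℚP.*-assoc (a s) (b j) (e j ÷ℕ d))) ⟨
  Σ< n (λ j → Σ< m (λ s → a s * b j * (e j ÷ℕ d))) ∎

corollary7 : (k : ℤ) (n m : ℕ) → 1 ≤ n → m % 2 ≡ 1 → (x : ℚ) →
    polyEuler k (n ∸ 1) x ≡
      Σ< n (λ l → ℕ→ℚ ((n ∸ 1) C l) * (ℕ→ℚ m ^q l) *
        Σ< (n ∸ l) (λ j′ → Σ< m (λ s →
          sgn s * EulerPoly l ((ℕ→ℚ s + x) ÷ℕ m)
            * invPowZ (suc j′) k * (S₁ (n ∸ l) (suc j′) ÷ℕ (n ∸ l)))))
corollary7 k zero    m ()
corollary7 k (suc n) m _ m-odd x = begin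
  polyEuler k n x
    ≡⟨ polyEuler-expansion k n x ⟩
  Σ< (suc n) (λ l → ℕ→ℚ (n C l) * EulerPoly l x * W l)
    ≡⟨ Σ<-cong (suc n) (λ l → cong (λ e → ℕ→ℚ (n C l) * e * W l) (EulerPoly-multiplication m m-odd x l)) ⟨
  Σ< (suc n) (λ l → ℕ→ℚ (n C l) * (ℕ→ℚ m ^q l * A l) * W l)
    ≡⟨ Σ<-cong (suc n) (λ l → trans (reassoc (ℕ→ℚ (n C l)) (ℕ→ℚ m ^q l) (A l) (W l))
                                      (cong (ℕ→ℚ (n C l) * ℕ→ℚ m ^q l *_) (Σ<-*-Σ<-÷ℕ m (suc n ∸ l) (suc n ∸ l) _ _ _))) ⟩
  _ ∎
  where
  W A : ℕ → ℚ
  W l = EiLogCoeff k (suc n ∸ l) ÷ℕ (suc n ∸ l)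
  A l = Σ< m (λ s → sgn s * EulerPoly l ((ℕ→ℚ s + x) ÷ℕ m))
  reassoc : ∀ c p a w → c * (p * a) * w ≡ c * p * (a * w)
  reassoc = solve 4 (λ c p a w → c :* (p :* a) :* w := c :* p :* (a :* w)) refl
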